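{- Let $d\ge 1$. If $G$ is a tree on $d+1$ vertices or the complete graph $K_{d+1}$, then the Ehrhart polynomial $E_{P_G^\ast}(n)$ is magic positive, i.e. writing $E_{P_G^\ast}(n)=\sum_{i=0}^d a_i n^i(1+n)^{d-i}$ one has $a_0,\ldots,a_d\ge 0$.
   Context: For a connected finite simple graph $G$ on vertex set $[d+1]$, the symmetric edge polytope $P_G$ is the convex hull of $\{\pm(e_v-e_w)\mid vw\in E(G)\}\subset\mathbb{R}^{d+1}$; it lies in the hyperplane $\sum x_i=0$. Identify the lattice $\mathbb{Z}^{d+1}\cap\{\sum x_i=0\}$ with $\mathbb{Z}^d$ by forgetting the last coordinate; then $P_G$ becomes a $d$-dimensional reflexive lattice polytope in $\mathbb{R}^d$, and $P_G^\ast=\{y\in\mathbb{R}^d\mid\langle x,y\rangle\le1\ \forall x\in P_G\}$ is its polar dual. The Ehrhart polynomial $E_P(n)$ of a lattice polytope $P\subset\mathbb{R}^d$ satisfies $E_P(n)=|nP\cap\mathbb{Z}^d|$ for integers $n>0$. -}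

module Defs where

open import Data.Nat as ℕ using (ℕ; zero; suc; _∸_)
open import Data.Fin as Fin using (Fin; toℕ; inject₁)
open import Data.Integer as ℤ using (ℤ; +_)
open import Data.Rational as ℚ using (ℚ; 0ℚ)
open import Data.Vec as Vec using (Vec; []; _∷_; tabulate; lookup)
open import Data.List as List using (List; length; _++_)
import Data.List.Relation.Unary.Unique.Propositional as UniqueP
open import Data.List.Membership.Propositional using (_∈_)
open import Data.Product using (Σ; _×_; _,_)
open import Data.Unit using (⊤)
open import Data.Bool using (if_then_else_)
open import Relation.Nullary using (¬_; does)
open import Relation.Binary.PropositionalEquality using (_≡_; _≢_)
open import Function.Bundles using (_⇔_)

record SimpleGraph (m : ℕ) : Set₁ where
  field
    Adj    : Fin m → Fin m → Set
    sym    : ∀ {v w} → Adj v w → Adj w v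
    irrefl : ∀ {v} → ¬ Adj v v

module _ {m : ℕ} (G : SimpleGraph m) where
  open SimpleGraph G

  data Walk : Fin m → Fin m → Set where
    nil  : ∀ {v} → Walk v v
    cons : ∀ {u v w} → Adj u v → Walk v w → Walk u w

  Connected : Set
  Connected = ∀ v w → Walk v w

  Chain : List (Fin m) → Set
  Chain List.[] = ⊤
  Chain (x List.∷ List.[]) = ⊤
  Chain (x List.∷ y List.∷ l) = Adj x y × Chain (y List.∷ l)

  IsCycle : Fin m → List (Fin m) → Set
  IsCycle v l = (2 ℕ.≤ length l)
              × UniqueP.Unique (v List.∷ l)
              × Chain (v List.∷ (l ++ v List.∷ List.[]))

  Acyclic : Set
  Acyclic = ∀ v l → ¬ IsCycle v l

  IsTree : Set
  IsTree = Connected × Acyclic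

  IsComplete : Set
  IsComplete = ∀ v w → v ≢ w → Adj v w

e : ∀ {k} → Fin k → Vec ℤ k
e v = tabulate (λ i → if does (i Fin.≟ v) then + 1 else + 0)

_-ᵥ_ : ∀ {k} → Vec ℤ k → Vec ℤ k → Vec ℤ k
x -ᵥ y = Vec.zipWith ℤ._-_ x y

-ᵥ_ : ∀ {k} → Vec ℤ k → Vec ℤ k
-ᵥ x = Vec.map ℤ.-_ x

-- identification ℤ^{d+1} ∩ {Σ xᵢ = 0} ≅ ℤ^d: forget the last coordinate
forget : ∀ {d} → Vec ℤ (suc d) → Vec ℤ d
forget x = tabulate (λ i → lookup x (inject₁ i))

dot : ∀ {d} → Vec ℤ d → Vec ℤ d → ℤ
dot [] [] = + 0
dot (x ∷ xs) (y ∷ ys) = x ℤ.* y ℤ.+ dot xs ys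

IsGenerator : ∀ {d} → SimpleGraph (suc d) → Vec ℤ d → Set
IsGenerator {d} G x =
  Σ (Fin (suc d)) λ v → Σ (Fin (suc d)) λ w → SimpleGraph.Adj G v w ×
    ((x ≡ forget (e v -ᵥ e w)) Data.Sum.⊎ (x ≡ forget (-ᵥ (e v -ᵥ e w))))
  where import Data.Sum

-- y ∈ n·P_G^*  (n > 0):  ⟨x , y⟩ ≤ n for every x ∈ P_G = conv(generators);
-- by linearity it suffices to test the generators.
InDilatedDual : ∀ {d} → SimpleGraph (suc d) → ℕ → Vec ℤ d → Set
InDilatedDual G n y = ∀ x → IsGenerator G x → dot x y ℤ.≤ + n

HasCard : ∀ {d} → (Vec ℤ d → Set) → ℕ → Set
HasCard {d} S k = Σ (List (Vec ℤ d)) λ L →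
  UniqueP.Unique L × (∀ y → (y ∈ L) ⇔ S y) × (length L ≡ k)

sumℚ : ∀ {k} → (Fin k → ℚ) → ℚ
sumℚ {zero} f = 0ℚ
sumℚ {suc k} f = f Fin.zero ℚ.+ sumℚ (λ i → f (Fin.suc i))

ℕtoℚ : ℕ → ℚ
ℕtoℚ k = + k ℚ./ 1

magicPoly : (d : ℕ) → (Fin (suc d) → ℚ) → ℕ → ℚ
magicPoly d a n =
  sumℚ (λ i → a i ℚ.* ℕtoℚ ((n ℕ.^ toℕ i) ℕ.* ((suc n) ℕ.^ (d ∸ toℕ i))))

EhrhartDualMagicPositive : (d : ℕ) → SimpleGraph (suc d) → Set
EhrhartDualMagicPositive d G =
  Σ (Fin (suc d) → ℚ) λ a →
    (∀ i → 0ℚ ℚ.≤ a i) ×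
    (∀ n → 1 ℕ.≤ n → Σ ℕ λ k → HasCard (InDilatedDual G n) k × (ℕtoℚ k ≡ magicPoly d a n))

module Submission where

-- Pair y ∈ ℤ^d with the height function Y = (y, 0) on the d + 1 vertices; then y ∈ n·P_G^*
-- iff |Y v − Y w| ≤ n along every edge vw.
-- For a tree rooted at the last vertex, y ↦ (Y v − Y (parent v))_{v ≠ root} is a bijection onto
-- the box [−n, n]^d (heights are recovered by summing increments towards the root), so
-- E(n) = (2n + 1)^d = Σ_i C(d, i) n^i (n + 1)^{d − i}.
-- For K_{d+1} the condition reads max Y − min Y ≤ n; translating Y so that its minimum is 0 is a
-- bijection onto the vectors of {0, …, n}^{d+1} containing a 0, so
-- E(n) = (n + 1)^{d+1} − n^{d+1} = Σ_i n^i (n + 1)^{d − i}.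

open import Defs
open import Algebra.Bundles using (Semiring)
import Algebra.Definitions.RawSemiring as RawSemiringDefinitions
import Algebra.Properties.CommutativeSemiring.Binomial as Binomial
open import Data.Empty using (⊥; ⊥-elim)
open import Data.Fin as Fin using (Fin; toℕ; inject₁; fromℕ)
open import Data.Fin.Properties using (_≟_; fromℕ≢inject₁)
open import Data.Fin.Relation.Unary.Top using (view; ‵fromℕ; ‵inject₁)
open import Data.Fin.Subset using (Subset; ⁅_⁆; _∪_; _⊆_) renaming (_∈_ to _∈ₛ_; _∉_ to _∉ₛ_)
open import Data.Fin.Subset.Properties
  using (x∈⁅x⁆; x∈⁅y⁆⇒x≡y; x∈p∪q⁺; x∈p∪q⁻; q⊆p∪q) renaming (_∈?_ to _∈ₛ?_)
open import Data.Integer as ℤ using (ℤ; +_)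
import Data.Integer.Properties as ℤP
open import Data.Integer.Tactic.RingSolver using (solve-∀)
open import Data.List as List using (List; []; _∷_; length; map; _++_; cartesianProductWith; allFin)
open import Data.List.Extrema ℤP.≤-totalOrder using (argmin; f[argmin]≤f[xs])
import Data.List.Membership.DecPropositional as DecMembership
open import Data.List.Membership.Propositional using (_∈_)
open import Data.List.Membership.Propositional.Properties
  using (∈-map⁺; ∈-map⁻; ∈-++⁺ˡ; ∈-++⁺ʳ; ∈-++⁻; ∈-allFin; ∈-cartesianProductWith⁺; ∈-cartesianProductWith⁻)
import Data.List.Properties as ListP
open import Data.List.Relation.Unary.All as ListAll using ([]; _∷_)
open import Data.List.Relation.Unary.AllPairs using ([]; _∷_)
open import Data.List.Relation.Unary.Any using (here; there)
open import Data.List.Relation.Unary.Unique.Propositional using (Unique)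
import Data.List.Relation.Unary.Unique.Propositional.Properties as Unique
open import Data.Nat as ℕ using (ℕ; zero; suc; _∸_; _<_; _≤_; s≤s; z≤n)
open import Data.Nat.Combinatorics using (_C_)
import Data.Nat.Properties as ℕP
open import Data.Product using (Σ; ∃; _×_; _,_; proj₁; proj₂)
open import Data.Rational as ℚ using (ℚ; 0ℚ)
import Data.Rational.Properties as ℚP
import Data.Rational.Unnormalised as ℚᵘ
import Data.Rational.Unnormalised.Properties as ℚᵘP
open import Data.Sum using (_⊎_; inj₁; inj₂)
open import Data.Unit using (tt)
open import Data.Vec as Vec using (Vec; []; _∷_; _∷ʳ_; lookup; tabulate)
open import Data.Vec.Functional using (updateAt)
open import Data.Vec.Functional.Properties using (updateAt-updates; updateAt-minimal)
open import Data.Vec.Membership.Propositional using () renaming (_∈_ to _∈ᵥ_)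
open import Data.Vec.Membership.Propositional.Properties using (∈-lookup)
import Data.Vec.Properties as VecP
open import Data.Vec.Relation.Unary.All as All using (All; []; _∷_)
open import Data.Vec.Relation.Unary.All.Properties using (lookup⁺; lookup⁻)
open import Data.Vec.Relation.Unary.Any using (here; there)
open import Function.Base using (_∘_)
open import Function.Bundles using (_⇔_; mk⇔; Equivalence)
open import Relation.Nullary using (yes; no)
open import Relation.Binary.PropositionalEquality
open import Algebra.Properties.Semiring.Sum ℕP.+-*-semiring using (sum; sum⁺-syntax; *-distribˡ-sum; sum-cong-≗)

open Equivalence using (to; from)

toℚᵘ-ℕtoℚ : ∀ k → ℚ.toℚᵘ (ℕtoℚ k) ℚᵘ.≃ ℚᵘ.mkℚᵘ (+ k) 0
toℚᵘ-ℕtoℚ k = ℚP.toℚᵘ-fromℚᵘ (ℚᵘ.mkℚᵘ (+ k) 0)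

ℕtoℚ-homo-+ : ∀ a b → ℕtoℚ (a ℕ.+ b) ≡ ℕtoℚ a ℚ.+ ℕtoℚ b
ℕtoℚ-homo-+ a b = ℚP.toℚᵘ-injective (begin
  ℚ.toℚᵘ (ℕtoℚ (a ℕ.+ b))              ≈⟨ toℚᵘ-ℕtoℚ (a ℕ.+ b) ⟩
  ℚᵘ.mkℚᵘ (+ (a ℕ.+ b)) 0              ≈⟨ ℚᵘ.*≡* (identity (+ a) (+ b)) ⟩
  ℚᵘ.mkℚᵘ (+ a) 0 ℚᵘ.+ ℚᵘ.mkℚᵘ (+ b) 0 ≈⟨ ℚᵘP.+-cong (toℚᵘ-ℕtoℚ a) (toℚᵘ-ℕtoℚ b) ⟨
  ℚ.toℚᵘ (ℕtoℚ a) ℚᵘ.+ ℚ.toℚᵘ (ℕtoℚ b) ≈⟨ ℚP.toℚᵘ-homo-+ (ℕtoℚ a) (ℕtoℚ b) ⟨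
  ℚ.toℚᵘ (ℕtoℚ a ℚ.+ ℕtoℚ b)           ∎)
  where
  open ℚᵘP.≃-Reasoning
  identity : ∀ x y → (x ℤ.+ y) ℤ.* (+ 1 ℤ.* + 1) ≡ (x ℤ.* + 1 ℤ.+ y ℤ.* + 1) ℤ.* + 1
  identity = solve-∀

ℕtoℚ-homo-* : ∀ a b → ℕtoℚ (a ℕ.* b) ≡ ℕtoℚ a ℚ.* ℕtoℚ b
ℕtoℚ-homo-* a b = ℚP.toℚᵘ-injective (begin
  ℚ.toℚᵘ (ℕtoℚ (a ℕ.* b))              ≈⟨ toℚᵘ-ℕtoℚ (a ℕ.* b) ⟩
  ℚᵘ.mkℚᵘ (+ (a ℕ.* b)) 0              ≈⟨ ℚᵘ.*≡* (trans (cong (ℤ._* (+ 1 ℤ.* + 1)) (ℤP.pos-* a b))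
                                                          (identity (+ a) (+ b))) ⟩
  ℚᵘ.mkℚᵘ (+ a) 0 ℚᵘ.* ℚᵘ.mkℚᵘ (+ b) 0 ≈⟨ ℚᵘP.*-cong (toℚᵘ-ℕtoℚ a) (toℚᵘ-ℕtoℚ b) ⟨
  ℚ.toℚᵘ (ℕtoℚ a) ℚᵘ.* ℚ.toℚᵘ (ℕtoℚ b) ≈⟨ ℚP.toℚᵘ-homo-* (ℕtoℚ a) (ℕtoℚ b) ⟨
  ℚ.toℚᵘ (ℕtoℚ a ℚ.* ℕtoℚ b)           ∎)
  where
  open ℚᵘP.≃-Reasoning
  identity : ∀ x y → (x ℤ.* y) ℤ.* (+ 1 ℤ.* + 1) ≡ (x ℤ.* y) ℤ.* + 1
  identity = solve-∀

ℕtoℚ-nonNegative : ∀ k → 0ℚ ℚ.≤ ℕtoℚ k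
ℕtoℚ-nonNegative k = ℚP.nonNegative⁻¹ (ℕtoℚ k) {{ℚP.normalize-nonNeg k 1}}

sumℚ-cong : ∀ {k} {f g : Fin k → ℚ} → (∀ i → f i ≡ g i) → sumℚ f ≡ sumℚ g
sumℚ-cong {zero}  f≗g = refl
sumℚ-cong {suc k} f≗g = cong₂ ℚ._+_ (f≗g Fin.zero) (sumℚ-cong (λ i → f≗g (Fin.suc i)))

sumℚ-ℕtoℚ : ∀ {k} (f : Fin k → ℕ) → sumℚ (λ i → ℕtoℚ (f i)) ≡ ℕtoℚ (sum f)
sumℚ-ℕtoℚ {zero}  f = refl
sumℚ-ℕtoℚ {suc k} f = begin
  ℕtoℚ (f Fin.zero) ℚ.+ sumℚ (λ i → ℕtoℚ (f (Fin.suc i)))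
    ≡⟨ cong (ℕtoℚ (f Fin.zero) ℚ.+_) (sumℚ-ℕtoℚ (λ i → f (Fin.suc i))) ⟩
  ℕtoℚ (f Fin.zero) ℚ.+ ℕtoℚ (sum (λ i → f (Fin.suc i)))
    ≡⟨ ℕtoℚ-homo-+ (f Fin.zero) _ ⟨
  ℕtoℚ (sum f)
    ∎
  where open ≡-Reasoning

magicTerm : ℕ → ℕ → ℕ → ℕ
magicTerm d n i = n ℕ.^ i ℕ.* suc n ℕ.^ (d ∸ i)

magicPoly-ℕtoℚ : ∀ d (a : Fin (suc d) → ℕ) n →
  magicPoly d (λ i → ℕtoℚ (a i)) n ≡ ℕtoℚ (∑[ i ≤ d ] (a i ℕ.* magicTerm d n (toℕ i)))
magicPoly-ℕtoℚ d a n = begin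
  sumℚ (λ i → ℕtoℚ (a i) ℚ.* ℕtoℚ (magicTerm d n (toℕ i)))
    ≡⟨ sumℚ-cong (λ i → ℕtoℚ-homo-* (a i) (magicTerm d n (toℕ i))) ⟨
  sumℚ (λ i → ℕtoℚ (a i ℕ.* magicTerm d n (toℕ i)))
    ≡⟨ sumℚ-ℕtoℚ (λ i → a i ℕ.* magicTerm d n (toℕ i)) ⟩
  ℕtoℚ (∑[ i ≤ d ] (a i ℕ.* magicTerm d n (toℕ i)))
    ∎
  where open ≡-Reasoning

module ℕSemiring = RawSemiringDefinitions (Semiring.rawSemiring ℕP.+-*-semiring)
module ℕBinomial = Binomial ℕP.+-*-commutativeSemiring

semiring-×≡* : ∀ k x → k ℕSemiring.× x ≡ k ℕ.* x
semiring-×≡* zero    x = refl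
semiring-×≡* (suc k) x = cong (x ℕ.+_) (semiring-×≡* k x)

semiring-^≡^ : ∀ x m → x ℕSemiring.^ m ≡ x ℕ.^ m
semiring-^≡^ x zero    = refl
semiring-^≡^ x (suc m) = cong (x ℕ.*_) (semiring-^≡^ x m)

binomial-magic : ∀ d n → (n ℕ.+ suc n) ℕ.^ d ≡ ∑[ i ≤ d ] ((d C toℕ i) ℕ.* magicTerm d n (toℕ i))
binomial-magic d n = begin
  (n ℕ.+ suc n) ℕ.^ d                     ≡⟨ semiring-^≡^ (n ℕ.+ suc n) d ⟨
  (n ℕ.+ suc n) ℕSemiring.^ d             ≡⟨ ℕBinomial.theorem d n (suc n) ⟩
  ℕBinomial.binomialExpansion n (suc n) d ≡⟨ sum-cong-≗ {suc d} term ⟩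
  ∑[ i ≤ d ] ((d C toℕ i) ℕ.* magicTerm d n (toℕ i)) ∎
  where
  open ≡-Reasoning
  term : ∀ i → ℕBinomial.binomialTerm n (suc n) d i ≡ (d C toℕ i) ℕ.* magicTerm d n (toℕ i)
  term i = trans (semiring-×≡* (d C toℕ i) _)
    (cong ((d C toℕ i) ℕ.*_) (cong₂ ℕ._*_ (semiring-^≡^ n (toℕ i)) (semiring-^≡^ (suc n) (d ∸ toℕ i))))

-- the number of words of length k over an alphabet of m + 1 letters in which a fixed letter occurs
containingCount : ℕ → ℕ → ℕ
containingCount m zero    = 0
containingCount m (suc k) = suc m ℕ.^ k ℕ.+ m ℕ.* containingCount m k

containingCount-magic : ∀ d m → containingCount m (suc d) ≡ ∑[ i ≤ d ] magicTerm d m (toℕ i)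
containingCount-magic zero    m = cong suc (ℕP.*-zeroʳ m)
containingCount-magic (suc d) m = cong₂ ℕ._+_ (sym (ℕP.*-identityˡ _)) (begin
  m ℕ.* containingCount m (suc d)               ≡⟨ cong (m ℕ.*_) (containingCount-magic d m) ⟩
  m ℕ.* ∑[ i ≤ d ] magicTerm d m (toℕ i)
    ≡⟨ *-distribˡ-sum m (λ (i : Fin (suc d)) → magicTerm d m (toℕ i)) ⟩
  ∑[ i ≤ d ] (m ℕ.* magicTerm d m (toℕ i))
    ≡⟨ sum-cong-≗ {suc d} (λ i → sym (ℕP.*-assoc m (m ℕ.^ toℕ i) (suc m ℕ.^ (d ∸ toℕ i)))) ⟩
  ∑[ i ≤ d ] magicTerm (suc d) m (suc (toℕ i))
    ∎)
  where open ≡-Reasoning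

magicExpansion⇒magicPositive : ∀ d (G : SimpleGraph (suc d)) (a : Fin (suc d) → ℕ) (count : ℕ → ℕ) →
  (∀ n → HasCard (InDilatedDual G n) (count n)) →
  (∀ n → count n ≡ ∑[ i ≤ d ] (a i ℕ.* magicTerm d n (toℕ i))) →
  EhrhartDualMagicPositive d G
magicExpansion⇒magicPositive d G a count hasCard expansion =
  (λ i → ℕtoℚ (a i)) , (λ i → ℕtoℚ-nonNegative (a i)) ,
  λ n _ → count n , hasCard n , trans (cong ℕtoℚ (expansion n)) (sym (magicPoly-ℕtoℚ d a n))

Enumerates : {A : Set} → List A → (A → Set) → Set
Enumerates L S = Unique L × (∀ x → x ∈ L ⇔ S x)

enumerates⇒HasCard : ∀ {d k} {L : List (Vec ℤ d)} {S} → Enumerates L S → length L ≡ k → HasCard S k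
enumerates⇒HasCard {L = L} (L-unique , L-enum) L-length = L , L-unique , L-enum , L-length

record SubsetBijection {a b : ℕ} (S : Vec ℤ a → Set) (T : Vec ℤ b → Set) : Set where
  field
    forward          : Vec ℤ a → Vec ℤ b
    backward         : Vec ℤ b → Vec ℤ a
    forward-∈        : ∀ {y} → S y → T (forward y)
    backward-∈       : ∀ {t} → T t → S (backward t)
    backward∘forward : ∀ {y} → S y → backward (forward y) ≡ y
    forward∘backward : ∀ {t} → T t → forward (backward t) ≡ t

HasCard-bijection : ∀ {a b k} {S : Vec ℤ a → Set} {T : Vec ℤ b → Set} →
  SubsetBijection S T → HasCard T k → HasCard S k
HasCard-bijection {S = S} β (L , L-unique , L-enum , L-length) =
  enumerates⇒HasCard (backward-unique , backward-enum) (trans (ListP.length-map backward L) L-length)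
  where
  open SubsetBijection β
  -- map forward undoes map backward on L, and Unique.map⁻ reflects uniqueness through map forward
  backward-unique : Unique (map backward L)
  backward-unique = Unique.map⁻ {f = forward} (subst Unique (sym (begin
    map forward (map backward L)       ≡⟨ ListP.map-∘ L ⟨
    map (λ t → forward (backward t)) L ≡⟨ ListP.map-id-local (ListAll.tabulate (forward∘backward ∘ to (L-enum _))) ⟩
    L                                  ∎)) L-unique)
    where open ≡-Reasoning
  backward-enum : ∀ y → y ∈ map backward L ⇔ S y
  backward-enum y = mk⇔
    (λ y∈ → let (t , t∈L , y≡) = ∈-map⁻ backward y∈ in subst S (sym y≡) (backward-∈ (to (L-enum t) t∈L)))
    (λ Sy → subst (_∈ map backward L) (backward∘forward Sy) (∈-map⁺ backward (from (L-enum _) (forward-∈ Sy))))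

InRange : ℤ → ℕ → ℤ → Set
InRange a l x = a ℤ.≤ x × x ℤ.< a ℤ.+ + l

range : ℤ → ℕ → List ℤ
range a zero    = []
range a (suc l) = a ∷ range (ℤ.suc a) l

length-range : ∀ a l → length (range a l) ≡ l
length-range a zero    = refl
length-range a (suc l) = cong suc (length-range (ℤ.suc a) l)

range-enumerates : ∀ a l → Enumerates (range a l) (InRange a l)
range-enumerates a l = unique a l , enum a l
  where
  suc-shift : ∀ a m → (+ 1 ℤ.+ a) ℤ.+ m ≡ a ℤ.+ (+ 1 ℤ.+ m)
  suc-shift = solve-∀
  enum : ∀ a l x → x ∈ range a l ⇔ InRange a l x
  enum a zero    x = mk⇔ (λ ()) λ (a≤x , x<a+0) → ⊥-elim
    (ℤP.<-irrefl refl (ℤP.<-≤-trans x<a+0 (subst (ℤ._≤ x) (sym (ℤP.+-identityʳ a)) a≤x)))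
  enum a (suc l) x = mk⇔ to′ from′
    where
    to′ : x ∈ range a (suc l) → InRange a (suc l) x
    to′ (here refl) = ℤP.≤-refl
                    , ℤP.suc[i]≤j⇒i<j (subst (ℤ.suc x ℤ.≤_) (suc-shift x (+ l)) (ℤP.i≤i+j (ℤ.suc x) (+ l)))
    to′ (there x∈)  = let (1+a≤x , x<) = to (enum (ℤ.suc a) l x) x∈ in
      ℤP.<⇒≤ (ℤP.suc[i]≤j⇒i<j 1+a≤x) , subst (x ℤ.<_) (suc-shift a (+ l)) x<
    from′ : InRange a (suc l) x → x ∈ range a (suc l)
    from′ (a≤x , x<) with x ℤ.≟ a
    ... | yes refl = here refl
    ... | no  x≢a  = there (from (enum (ℤ.suc a) l x)
          (ℤP.i<j⇒suc[i]≤j (ℤP.≤∧≢⇒< a≤x (x≢a ∘ sym)) , subst (x ℤ.<_) (sym (suc-shift a (+ l))) x<))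
  unique : ∀ a l → Unique (range a l)
  unique a zero    = []
  unique a (suc l) =
    ListAll.tabulate (λ {x} x∈ a≡x → ℤP.<-irrefl a≡x (ℤP.suc[i]≤j⇒i<j (proj₁ (to (enum (ℤ.suc a) l x) x∈))))
    ∷ unique (ℤ.suc a) l

length-cartesianProductWith : ∀ {A B C : Set} (f : A → B → C) (xs : List A) (ys : List B) →
  length (cartesianProductWith f xs ys) ≡ length xs ℕ.* length ys
length-cartesianProductWith f []       ys = refl
length-cartesianProductWith f (x ∷ xs) ys = trans (ListP.length-++ (map (f x) ys))
  (cong₂ ℕ._+_ (ListP.length-map (f x) ys) (length-cartesianProductWith f xs ys))

module _ {A : Set} where

  ∷-injective : ∀ {k} {x x′ : A} {xs xs′ : Vec A k} → x ∷ xs ≡ x′ ∷ xs′ → x ≡ x′ × xs ≡ xs′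
  ∷-injective refl = refl , refl

  ∈-cartesianProduct∷⁻ : ∀ {k} L (M : List (Vec A k)) {x xs} →
                         x ∷ xs ∈ cartesianProductWith _∷_ L M → x ∈ L × xs ∈ M
  ∈-cartesianProduct∷⁻ L M x∷xs∈ with ∈-cartesianProductWith⁻ _∷_ L M x∷xs∈
  ... | _ , _ , x∈ , xs∈ , eq with ∷-injective eq
  ...   | refl , refl = x∈ , xs∈

  vectors : List A → (k : ℕ) → List (Vec A k)
  vectors L zero    = [] ∷ []
  vectors L (suc k) = cartesianProductWith _∷_ L (vectors L k)

  length-vectors : ∀ L k → length (vectors L k) ≡ length L ℕ.^ k
  length-vectors L zero    = refl
  length-vectors L (suc k) =
    trans (length-cartesianProductWith _∷_ L (vectors L k)) (cong (length L ℕ.*_) (length-vectors L k))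

  vectors-enumerates : ∀ {L S} → Enumerates L S → ∀ k → Enumerates (vectors L k) (All S)
  vectors-enumerates {L} {S} (L-unique , L-enum) k = unique k , enum k
    where
    unique : ∀ k → Unique (vectors L k)
    unique zero    = ListAll.[] ∷ []
    unique (suc k) = Unique.cartesianProductWith⁺ _∷_ ∷-injective L-unique (unique k)
    enum : ∀ k xs → xs ∈ vectors L k ⇔ All S xs
    enum zero    []       = mk⇔ (λ _ → []) (λ _ → here refl)
    enum (suc k) (x ∷ xs) = mk⇔
      (λ x∷xs∈ → let (x∈ , xs∈) = ∈-cartesianProduct∷⁻ L (vectors L k) x∷xs∈
                 in to (L-enum x) x∈ ∷ to (enum k xs) xs∈)
      (λ { (Sx ∷ Sxs) → ∈-cartesianProductWith⁺ _∷_ (from (L-enum x) Sx) (from (enum k xs) Sxs) })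

  containing : A → List A → (k : ℕ) → List (Vec A k)
  containing c L zero    = []
  containing c L (suc k) = map (c ∷_) (vectors (c ∷ L) k) ++ cartesianProductWith _∷_ L (containing c L k)

  length-containing : ∀ c L k → length (containing c L k) ≡ containingCount (length L) k
  length-containing c L zero    = refl
  length-containing c L (suc k) = begin
    length (map (c ∷_) (vectors (c ∷ L) k) ++ cartesianProductWith _∷_ L (containing c L k))
      ≡⟨ ListP.length-++ (map (c ∷_) (vectors (c ∷ L) k)) ⟩
    length (map (c ∷_) (vectors (c ∷ L) k)) ℕ.+ length (cartesianProductWith _∷_ L (containing c L k))
      ≡⟨ cong₂ ℕ._+_ (trans (ListP.length-map (c ∷_) (vectors (c ∷ L) k)) (length-vectors (c ∷ L) k))
                     (trans (length-cartesianProductWith _∷_ L (containing c L k))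
                            (cong (length L ℕ.*_) (length-containing c L k))) ⟩
    containingCount (length L) (suc k)
      ∎
    where open ≡-Reasoning

  containing-enumerates : ∀ {c L S} → Enumerates (c ∷ L) S → ∀ k →
    Enumerates (containing c L k) (λ xs → All S xs × c ∈ᵥ xs)
  containing-enumerates {c} {L} {S} cL-enumerates@(c∉L ∷ L-unique , cL-enum) k = unique k , enum k
    where
    vectors-enum : ∀ k xs → xs ∈ vectors (c ∷ L) k ⇔ All S xs
    vectors-enum k = proj₂ (vectors-enumerates cL-enumerates k)
    unique : ∀ k → Unique (containing c L k)
    unique zero    = []
    unique (suc k) = Unique.++⁺
      (Unique.map⁺ (proj₂ ∘ ∷-injective) (proj₁ (vectors-enumerates cL-enumerates k)))
      (Unique.cartesianProductWith⁺ _∷_ ∷-injective L-unique (unique k))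
      λ (v∈ˡ , v∈ʳ) → let (_ , _ , v≡c∷) = ∈-map⁻ (c ∷_) v∈ˡ
                          (_ , _ , x∈L , _ , v≡x∷) = ∈-cartesianProductWith⁻ _∷_ L (containing c L k) v∈ʳ
                      in ListAll.lookup c∉L x∈L (proj₁ (∷-injective (trans (sym v≡c∷) v≡x∷)))
    enum : ∀ k xs → xs ∈ containing c L k ⇔ (All S xs × c ∈ᵥ xs)
    enum zero    []       = mk⇔ (λ ()) (λ ())
    enum (suc k) (x ∷ xs) = mk⇔ to′ from′
      where
      to′ : x ∷ xs ∈ containing c L (suc k) → All S (x ∷ xs) × c ∈ᵥ x ∷ xs
      to′ x∷xs∈ with ∈-++⁻ (map (c ∷_) (vectors (c ∷ L) k)) x∷xs∈
      ... | inj₁ x∷xs∈ˡ with ∈-map⁻ (c ∷_) x∷xs∈ˡ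
      ...   | _ , xs∈ , refl = (to (cL-enum c) (here refl) ∷ to (vectors-enum k xs) xs∈) , here refl
      to′ x∷xs∈ | inj₂ x∷xs∈ʳ with ∈-cartesianProduct∷⁻ L (containing c L k) x∷xs∈ʳ
      ...   | x∈L , xs∈ = let (Sxs , c∈xs) = to (enum k xs) xs∈
                          in (to (cL-enum x) (there x∈L) ∷ Sxs) , there c∈xs
      from′ : All S (x ∷ xs) × c ∈ᵥ x ∷ xs → x ∷ xs ∈ containing c L (suc k)
      from′ (Sx ∷ Sxs , c∈x∷xs) with from (cL-enum x) Sx | c∈x∷xs
      ... | here refl | _          = ∈-++⁺ˡ (∈-map⁺ (c ∷_) (from (vectors-enum k xs) Sxs))
      ... | there x∈L | here c≡x   = ⊥-elim (ListAll.lookup c∉L x∈L c≡x)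
      ... | there x∈L | there c∈xs = ∈-++⁺ʳ (map (c ∷_) (vectors (c ∷ L) k))
                                       (∈-cartesianProductWith⁺ _∷_ x∈L (from (enum k xs) (Sxs , c∈xs)))

HasCard-box : ∀ d a l → HasCard {d} (All (InRange a l)) (l ℕ.^ d)
HasCard-box d a l = enumerates⇒HasCard (vectors-enumerates (range-enumerates a l) d)
  (trans (length-vectors (range a l) d) (cong (ℕ._^ d) (length-range a l)))

HasCard-boxContainingZero : ∀ d n →
  HasCard {d} (λ z → All (InRange (+ 0) (suc n)) z × + 0 ∈ᵥ z) (containingCount n d)
HasCard-boxContainingZero d n = enumerates⇒HasCard (containing-enumerates (range-enumerates (+ 0) (suc n)) d)
  (trans (length-containing (+ 0) (range (+ 1) n) d) (cong (λ m → containingCount m d) (length-range (+ 1) n)))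

-- y ∈ ℤ^d as a function on the d + 1 vertices vanishing at the last one; dot-forget shows this is
-- how y pairs with the points of P_G
extend : ∀ {d} → Vec ℤ d → Fin (suc d) → ℤ
extend y = lookup (y ∷ʳ + 0)

restrict : ∀ {d} → (Fin (suc d) → ℤ) → Vec ℤ d
restrict Y = tabulate (λ i → Y (inject₁ i))

extend-inject₁ : ∀ {d} (y : Vec ℤ d) i → extend y (inject₁ i) ≡ lookup y i
extend-inject₁ (x ∷ xs) Fin.zero    = refl
extend-inject₁ (x ∷ xs) (Fin.suc i) = extend-inject₁ xs i

extend-last : ∀ {d} (y : Vec ℤ d) → extend y (fromℕ d) ≡ + 0
extend-last []       = refl
extend-last (x ∷ xs) = extend-last xs

extend-All : ∀ {d} {P : ℤ → Set} {y : Vec ℤ d} → All P y → ∀ {v} → v ≢ fromℕ d → P (extend y v)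
extend-All {P = P} {y} Py {v} v≢last with view v
... | ‵fromℕ     = ⊥-elim (v≢last refl)
... | ‵inject₁ i = subst P (sym (extend-inject₁ y i)) (lookup⁺ Py i)

restrict-extend : ∀ {d} (y : Vec ℤ d) → restrict (extend y) ≡ y
restrict-extend y = trans (VecP.tabulate-cong (extend-inject₁ y)) (VecP.tabulate∘lookup y)

extend-restrict-≢ : ∀ {d} (Y : Fin (suc d) → ℤ) {v} → v ≢ fromℕ d → extend (restrict Y) v ≡ Y v
extend-restrict-≢ Y {v} v≢last with view v
... | ‵fromℕ     = ⊥-elim (v≢last refl)
... | ‵inject₁ i = trans (extend-inject₁ (restrict Y) i) (VecP.lookup∘tabulate (λ j → Y (inject₁ j)) i)

extend-restrict : ∀ {d} (Y : Fin (suc d) → ℤ) → Y (fromℕ d) ≡ + 0 → ∀ v → extend (restrict Y) v ≡ Y v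
extend-restrict {d} Y Y-last v with v ≟ fromℕ d
... | yes refl    = trans (extend-last (restrict Y)) (sym Y-last)
... | no  v≢last  = extend-restrict-≢ Y v≢last

neg-minus : ∀ a b → ℤ.- (a ℤ.- b) ≡ b ℤ.- a
neg-minus = solve-∀

[a-c]-[b-c]≡a-b : ∀ a b c → (a ℤ.- c) ℤ.- (b ℤ.- c) ≡ a ℤ.- b
[a-c]-[b-c]≡a-b = solve-∀

dot-forget : ∀ {d} (x : Vec ℤ (suc d)) (y : Vec ℤ d) → dot (forget x) y ≡ dot x (y ∷ʳ + 0)
dot-forget (x ∷ [])      []       = sym (trans (ℤP.+-identityʳ (x ℤ.* + 0)) (ℤP.*-zeroʳ x))
dot-forget (x ∷ x′ ∷ xs) (y ∷ ys) = cong (ℤ._+_ (x ℤ.* y)) (dot-forget (x′ ∷ xs) ys)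

dot-zeroˡ : ∀ {k} (z : Vec ℤ k) → dot (tabulate (λ _ → + 0)) z ≡ + 0
dot-zeroˡ []       = refl
dot-zeroˡ (z ∷ zs) = trans (ℤP.+-identityˡ _) (dot-zeroˡ zs)

dot-e : ∀ {k} (u : Fin k) (z : Vec ℤ k) → dot (e u) z ≡ lookup z u
dot-e Fin.zero    (z ∷ zs) = trans (cong₂ ℤ._+_ (ℤP.*-identityˡ z) (dot-zeroˡ zs)) (ℤP.+-identityʳ z)
dot-e (Fin.suc u) (z ∷ zs) = trans (ℤP.+-identityˡ _) (dot-e u zs)

dot-minusˡ : ∀ {k} (x x′ z : Vec ℤ k) → dot (x -ᵥ x′) z ≡ dot x z ℤ.- dot x′ z
dot-minusˡ []       []         []       = refl
dot-minusˡ (x ∷ xs) (x′ ∷ xs′) (z ∷ zs) =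
  trans (cong (ℤ._+_ ((x ℤ.- x′) ℤ.* z)) (dot-minusˡ xs xs′ zs)) (identity x x′ z (dot xs zs) (dot xs′ zs))
  where
  identity : ∀ a b c p q → (a ℤ.- b) ℤ.* c ℤ.+ (p ℤ.- q) ≡ (a ℤ.* c ℤ.+ p) ℤ.- (b ℤ.* c ℤ.+ q)
  identity = solve-∀

dot-negˡ : ∀ {k} (x z : Vec ℤ k) → dot (-ᵥ x) z ≡ ℤ.- dot x z
dot-negˡ []       []       = refl
dot-negˡ (x ∷ xs) (z ∷ zs) = trans (cong (ℤ._+_ (ℤ.- x ℤ.* z)) (dot-negˡ xs zs)) (identity x z (dot xs zs))
  where
  identity : ∀ a c p → ℤ.- a ℤ.* c ℤ.+ ℤ.- p ≡ ℤ.- (a ℤ.* c ℤ.+ p)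
  identity = solve-∀

dot-generator : ∀ {d} (v w : Fin (suc d)) (y : Vec ℤ d) →
  dot (forget (e v -ᵥ e w)) y ≡ extend y v ℤ.- extend y w
dot-generator v w y = begin
  dot (forget (e v -ᵥ e w)) y                   ≡⟨ dot-forget (e v -ᵥ e w) y ⟩
  dot (e v -ᵥ e w) (y ∷ʳ + 0)                   ≡⟨ dot-minusˡ (e v) (e w) (y ∷ʳ + 0) ⟩
  dot (e v) (y ∷ʳ + 0) ℤ.- dot (e w) (y ∷ʳ + 0) ≡⟨ cong₂ ℤ._-_ (dot-e v (y ∷ʳ + 0)) (dot-e w (y ∷ʳ + 0)) ⟩
  extend y v ℤ.- extend y w                     ∎
  where open ≡-Reasoning

dot-negGenerator : ∀ {d} (v w : Fin (suc d)) (y : Vec ℤ d) →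
  dot (forget (-ᵥ (e v -ᵥ e w))) y ≡ extend y w ℤ.- extend y v
dot-negGenerator v w y = begin
  dot (forget (-ᵥ (e v -ᵥ e w))) y ≡⟨ dot-forget (-ᵥ (e v -ᵥ e w)) y ⟩
  dot (-ᵥ (e v -ᵥ e w)) (y ∷ʳ + 0) ≡⟨ dot-negˡ (e v -ᵥ e w) (y ∷ʳ + 0) ⟩
  ℤ.- dot (e v -ᵥ e w) (y ∷ʳ + 0)  ≡⟨ cong ℤ.-_ (sym (dot-forget (e v -ᵥ e w) y)) ⟩
  ℤ.- dot (forget (e v -ᵥ e w)) y  ≡⟨ cong ℤ.-_ (dot-generator v w y) ⟩
  ℤ.- (extend y v ℤ.- extend y w)  ≡⟨ neg-minus (extend y v) (extend y w) ⟩
  extend y w ℤ.- extend y v        ∎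
  where open ≡-Reasoning

EdgeBounded : ∀ {d} → SimpleGraph (suc d) → ℕ → (Fin (suc d) → ℤ) → Set
EdgeBounded G n Y = ∀ {v w} → SimpleGraph.Adj G v w → Y v ℤ.- Y w ℤ.≤ + n

inDilatedDual⇔edgeBounded : ∀ {d} (G : SimpleGraph (suc d)) n (y : Vec ℤ d) →
  InDilatedDual G n y ⇔ EdgeBounded G n (extend y)
inDilatedDual⇔edgeBounded G n y = mk⇔
  (λ y∈ {v} {w} vw → subst (ℤ._≤ + n) (dot-generator v w y) (y∈ _ (v , w , vw , inj₁ refl)))
  λ { bounded x (v , w , vw , inj₁ refl) → subst (ℤ._≤ + n) (sym (dot-generator v w y)) (bounded vw)
    ; bounded x (v , w , vw , inj₂ refl) →
        subst (ℤ._≤ + n) (sym (dot-negGenerator v w y)) (bounded (SimpleGraph.sym G vw)) }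

module _ {k : ℕ} (f : Fin (suc k) → ℤ) where

  argminVertex : Fin (suc k)
  argminVertex = argmin f Fin.zero (allFin (suc k))

  argminVertex-minimal : ∀ v → f argminVertex ℤ.≤ f v
  argminVertex-minimal v = ListAll.lookup (f[argmin]≤f[xs] {f = f} Fin.zero (allFin (suc k))) (∈-allFin v)

module CompleteGraph {d : ℕ} (G : SimpleGraph (suc d)) (complete : IsComplete G) (n : ℕ) where

  BoxContainingZero : Vec ℤ (suc d) → Set
  BoxContainingZero z = All (InRange (+ 0) (suc n)) z × + 0 ∈ᵥ z

  edgeBounded⇒spread≤ : ∀ {Y} → EdgeBounded G n Y → ∀ v w → Y v ℤ.- Y w ℤ.≤ + n
  edgeBounded⇒spread≤ {Y} bounded v w with v ≟ w
  ... | yes refl = subst (ℤ._≤ + n) (sym (ℤP.+-inverseʳ (Y v))) (ℤ.+≤+ z≤n)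
  ... | no  v≢w  = bounded (complete v w v≢w)

  shiftToMin : (Fin (suc d) → ℤ) → Fin (suc d) → ℤ
  shiftToMin Y v = Y v ℤ.- Y (argminVertex Y)

  normalise : Vec ℤ d → Vec ℤ (suc d)
  normalise y = tabulate (shiftToMin (extend y))

  differencesToLast : Vec ℤ (suc d) → Vec ℤ d
  differencesToLast z = restrict (λ v → lookup z v ℤ.- lookup z (fromℕ d))

  extend-differencesToLast : ∀ z v → extend (differencesToLast z) v ≡ lookup z v ℤ.- lookup z (fromℕ d)
  extend-differencesToLast z = extend-restrict _ (ℤP.+-inverseʳ (lookup z (fromℕ d)))

  normalise-∈ : ∀ {y} → InDilatedDual G n y → BoxContainingZero (normalise y)
  normalise-∈ {y} y∈ = lookup⁻ inBox , subst (_∈ᵥ normalise y) zero-at-m (∈-lookup m (normalise y))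
    where
    Y : Fin (suc d) → ℤ
    Y = extend y
    m : Fin (suc d)
    m = argminVertex Y
    inBox : ∀ v → InRange (+ 0) (suc n) (lookup (normalise y) v)
    inBox v = subst (InRange (+ 0) (suc n)) (sym (VecP.lookup∘tabulate (shiftToMin Y) v))
      ( ℤP.i≤j⇒0≤j-i (argminVertex-minimal Y v)
      , ℤP.i≤pred[j]⇒i<j (edgeBounded⇒spread≤ {Y} (to (inDilatedDual⇔edgeBounded G n y) y∈) v m))
    zero-at-m : lookup (normalise y) m ≡ + 0
    zero-at-m = trans (VecP.lookup∘tabulate (shiftToMin Y) m) (ℤP.+-inverseʳ (Y m))

  differencesToLast-∈ : ∀ {z} → BoxContainingZero z → InDilatedDual G n (differencesToLast z)
  differencesToLast-∈ {z} (z∈box , _) = from (inDilatedDual⇔edgeBounded G n (differencesToLast z)) λ {v} {w} _ →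
    subst (ℤ._≤ + n) (sym (difference v w))
      (ℤP.≤-trans (ℤP.i-j≤i (lookup z v) (lookup z w) {{ℤ.nonNegative (proj₁ (lookup⁺ z∈box w))}})
                  (ℤP.i<j⇒i≤pred[j] (proj₂ (lookup⁺ z∈box v))))
    where
    difference : ∀ v w → extend (differencesToLast z) v ℤ.- extend (differencesToLast z) w ≡ lookup z v ℤ.- lookup z w
    difference v w = trans (cong₂ ℤ._-_ (extend-differencesToLast z v) (extend-differencesToLast z w))
                           ([a-c]-[b-c]≡a-b (lookup z v) (lookup z w) (lookup z (fromℕ d)))

  differencesToLast∘normalise : ∀ y → differencesToLast (normalise y) ≡ y
  differencesToLast∘normalise y = trans (VecP.tabulate-cong (λ i → pointwise (inject₁ i))) (restrict-extend y)
    where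
    open ≡-Reasoning
    Y : Fin (suc d) → ℤ
    Y = extend y
    m : Fin (suc d)
    m = argminVertex Y
    pointwise : ∀ v → lookup (normalise y) v ℤ.- lookup (normalise y) (fromℕ d) ≡ Y v
    pointwise v = begin
      lookup (normalise y) v ℤ.- lookup (normalise y) (fromℕ d)
        ≡⟨ cong₂ ℤ._-_ (VecP.lookup∘tabulate (shiftToMin Y) v) (VecP.lookup∘tabulate (shiftToMin Y) (fromℕ d)) ⟩
      (Y v ℤ.- Y m) ℤ.- (Y (fromℕ d) ℤ.- Y m) ≡⟨ [a-c]-[b-c]≡a-b (Y v) (Y (fromℕ d)) (Y m) ⟩
      Y v ℤ.- Y (fromℕ d)                    ≡⟨ cong (ℤ._-_ (Y v)) (extend-last y) ⟩
      Y v ℤ.- + 0                            ≡⟨ ℤP.+-identityʳ (Y v) ⟩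
      Y v                                    ∎

  normalise∘differencesToLast : ∀ {z} → BoxContainingZero z → normalise (differencesToLast z) ≡ z
  normalise∘differencesToLast {z} (z∈box , 0∈z) = trans (VecP.tabulate-cong pointwise) (VecP.tabulate∘lookup z)
    where
    open ≡-Reasoning
    Y : Fin (suc d) → ℤ
    Y = extend (differencesToLast z)
    m : Fin (suc d)
    m = argminVertex Y
    last : ℤ
    last = lookup z (fromℕ d)
    -- ≤ compares Y m with Y at an index where z vanishes; ≥ holds since z m ≥ 0
    Y-min : Y m ≡ ℤ.- last
    Y-min = ℤP.≤-antisym
      (subst (Y m ℤ.≤_) (ℤP.+-identityˡ (ℤ.- last))
        (All.lookup (lookup⁻ {P = λ x → Y m ℤ.≤ x ℤ.- last}
                      (λ v → subst (Y m ℤ.≤_) (extend-differencesToLast z v) (argminVertex-minimal Y v))) 0∈z))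
      (subst₂ ℤ._≤_ (ℤP.+-identityˡ (ℤ.- last)) (sym (extend-differencesToLast z m))
        (ℤP.+-monoˡ-≤ (ℤ.- last) (proj₁ (lookup⁺ z∈box m))))
    pointwise : ∀ v → shiftToMin Y v ≡ lookup z v
    pointwise v = begin
      Y v ℤ.- Y m                        ≡⟨ cong₂ ℤ._-_ (extend-differencesToLast z v) Y-min ⟩
      (lookup z v ℤ.- last) ℤ.- ℤ.- last ≡⟨ identity (lookup z v) last ⟩
      lookup z v                         ∎
      where
      identity : ∀ a c → (a ℤ.- c) ℤ.- ℤ.- c ≡ a
      identity = solve-∀

  normalisation : SubsetBijection (InDilatedDual G n) BoxContainingZero
  normalisation = record
    { forward          = normalise
    ; backward         = differencesToLast
    ; forward-∈        = normalise-∈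
    ; backward-∈       = differencesToLast-∈
    ; backward∘forward = λ {y} _ → differencesToLast∘normalise y
    ; forward∘backward = normalise∘differencesToLast
    }

-- trees are rooted at the last vertex, where the heights extend y vanish
root : ∀ {d} → Fin (suc d)
root = fromℕ _

record RootedSubtree {d : ℕ} (G : SimpleGraph (suc d)) (S : Subset (suc d)) : Set where
  open SimpleGraph G using (Adj)
  field
    parent       : Fin (suc d) → Fin (suc d)
    depth        : Fin (suc d) → ℕ
    root∈        : root ∈ₛ S
    parent∈      : ∀ {v} → v ∈ₛ S → v ≢ root → parent v ∈ₛ S
    parent-adj   : ∀ {v} → v ∈ₛ S → v ≢ root → Adj v (parent v)
    depth-parent : ∀ {v} → v ∈ₛ S → v ≢ root → depth (parent v) < depth v
    parent-edge  : ∀ {u w} → u ∈ₛ S → w ∈ₛ S → Adj u w →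
                   (u ≢ root × parent u ≡ w) ⊎ (w ≢ root × parent w ≡ u)

module Walks {d : ℕ} (G : SimpleGraph (suc d)) where
  open SimpleGraph G using (Adj) renaming (sym to Adj-sym)
  open DecMembership (_≟_ {suc d}) using () renaming (_∈?_ to _∈ₗ?_)

  data WalkIn (S : Subset (suc d)) : Fin (suc d) → Fin (suc d) → Set where
    stop : ∀ {v} → v ∈ₛ S → WalkIn S v v
    step : ∀ {u v w} → u ∈ₛ S → Adj u v → WalkIn S v w → WalkIn S u w

  module _ {S : Subset (suc d)} where

    vertices : ∀ {u w} → WalkIn S u w → List (Fin (suc d))
    vertices (stop {v} _)     = v ∷ []
    vertices (step {u} _ _ p) = u ∷ vertices p

    vertices-∈ : ∀ {u w} (p : WalkIn S u w) → ListAll.All (_∈ₛ S) (vertices p)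
    vertices-∈ (stop v∈)     = v∈ ∷ []
    vertices-∈ (step u∈ _ p) = u∈ ∷ vertices-∈ p

    _▷_ : ∀ {u v w} → WalkIn S u v → Adj v w × w ∈ₛ S → WalkIn S u w
    stop v∈      ▷ (vw , w∈) = step v∈ vw (stop w∈)
    step u∈ uv p ▷ (vw , w∈) = step u∈ uv (p ▷ (vw , w∈))

    Simple : ∀ {u w} → WalkIn S u w → Set
    Simple p = Unique (vertices p)

    suffix : ∀ {v w x} (p : WalkIn S v w) → Simple p → x ∈ vertices p → Σ (WalkIn S x w) Simple
    suffix (stop v∈)      _              (here refl) = stop v∈ , [] ∷ []
    suffix p@(step _ _ _) p-simple       (here refl) = p , p-simple
    suffix (step _ _ p)   (_ ∷ p-simple) (there x∈)  = suffix p p-simple x∈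

    loopErase : ∀ {u w} → WalkIn S u w → Σ (WalkIn S u w) Simple
    loopErase (stop v∈) = stop v∈ , [] ∷ []
    loopErase (step {u} u∈ uv p) with loopErase p
    ... | p′ , p′-simple with u ∈ₗ? vertices p′
    ...   | yes u∈p′ = suffix p′ p′-simple u∈p′
    ...   | no  u∉p′ = step u∈ uv p′ , ListAll.tabulate (λ { x∈ refl → u∉p′ x∈ }) ∷ p′-simple

    chain-closing : ∀ {u w a} → Adj w a → (p : WalkIn S u w) → Chain G (vertices p ++ a ∷ [])
    chain-closing wa (stop _)                   = wa , tt
    chain-closing wa (step _ uv (stop _))       = uv , wa , tt
    chain-closing wa (step _ uv p@(step _ _ _)) = uv , chain-closing wa p

  closesCycle : ∀ {S a b w} → Acyclic G → a ∉ₛ S → Adj a b → Adj w a → b ≢ w →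
                (p : WalkIn S b w) → Simple p → ⊥
  closesCycle acyclic a∉S ab wa b≢w (stop _) _ = b≢w refl
  closesCycle {a = a} acyclic a∉S ab wa b≢w p@(step _ _ p′) p-simple =
    acyclic a (vertices p) (two≤ p′ , a∉p ∷ p-simple , ab , chain-closing wa p)
    where
    two≤ : ∀ {v w} (q : WalkIn _ v w) → 2 ≤ suc (length (vertices q))
    two≤ (stop _)     = s≤s (s≤s z≤n)
    two≤ (step _ _ _) = s≤s (s≤s z≤n)
    a∉p : ListAll.All (a ≢_) (vertices p)
    a∉p = ListAll.tabulate λ x∈ a≡x → a∉S (subst (_∈ₛ _) (sym a≡x) (ListAll.lookup (vertices-∈ p) x∈))

module _ {d : ℕ} {G : SimpleGraph (suc d)} {S : Subset (suc d)} (ρ : RootedSubtree G S) where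
  open SimpleGraph G using (Adj) renaming (sym to Adj-sym)
  open RootedSubtree ρ
  open Walks G

  descendTo : ∀ {u k} → WalkIn S u root → ∀ w → w ∈ₛ S → depth w < k → WalkIn S u w
  descendTo {k = suc k} p w w∈ (s≤s depth≤k) with w ≟ root
  ... | yes refl  = p
  ... | no w≢root = descendTo p (parent w) (parent∈ w∈ w≢root) (ℕP.<-≤-trans (depth-parent w∈ w≢root) depth≤k)
                    ▷ (Adj-sym (parent-adj w∈ w≢root) , w∈)

  ascendFrom : ∀ {k} v → v ∈ₛ S → depth v < k → WalkIn S v root
  ascendFrom {suc k} v v∈ (s≤s depth≤k) with v ≟ root
  ... | yes refl  = stop v∈
  ... | no v≢root = step v∈ (parent-adj v∈ v≢root)
                      (ascendFrom (parent v) (parent∈ v∈ v≢root) (ℕP.<-≤-trans (depth-parent v∈ v≢root) depth≤k))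

  walkBetween : ∀ {u w} → u ∈ₛ S → w ∈ₛ S → WalkIn S u w
  walkBetween {u} {w} u∈ w∈ = descendTo (ascendFrom u u∈ ℕP.≤-refl) w w∈ ℕP.≤-refl

  uniqueNeighbour : Acyclic G → ∀ {a b w} → a ∉ₛ S → b ∈ₛ S → w ∈ₛ S → Adj a b → Adj a w → w ≡ b
  uniqueNeighbour acyclic {a} {b} {w} a∉S b∈ w∈ ab aw with w ≟ b
  ... | yes w≡b = w≡b
  ... | no  w≢b = let (p , p-simple) = loopErase (walkBetween b∈ w∈) in
                  ⊥-elim (closesCycle acyclic a∉S ab (Adj-sym aw) (w≢b ∘ sym) p p-simple)

∈-⁅⁆∪⁻ : ∀ {m} {S : Subset m} {a v} → v ∈ₛ ⁅ a ⁆ ∪ S → v ≡ a ⊎ v ∈ₛ S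
∈-⁅⁆∪⁻ {S = S} {a} v∈ with x∈p∪q⁻ ⁅ a ⁆ S v∈
... | inj₁ v∈⁅a⁆ = inj₁ (x∈⁅y⁆⇒x≡y a v∈⁅a⁆)
... | inj₂ v∈S   = inj₂ v∈S

rootOnly : ∀ {d} {G : SimpleGraph (suc d)} → RootedSubtree G ⁅ root ⁆
rootOnly {G = G} = record
  { parent       = λ v → v
  ; depth        = λ _ → 0
  ; root∈        = x∈⁅x⁆ root
  ; parent∈      = λ v∈ v≢root → ⊥-elim (v≢root (isRoot v∈))
  ; parent-adj   = λ v∈ v≢root → ⊥-elim (v≢root (isRoot v∈))
  ; depth-parent = λ v∈ v≢root → ⊥-elim (v≢root (isRoot v∈))
  ; parent-edge  = λ u∈ w∈ uw → ⊥-elim (irrefl (subst₂ Adj (isRoot u∈) (isRoot w∈) uw))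
  }
  where
  open SimpleGraph G using (Adj; irrefl)
  isRoot : ∀ {v} → v ∈ₛ ⁅ root ⁆ → v ≡ root
  isRoot = x∈⁅y⁆⇒x≡y root

module Attach {d : ℕ} {G : SimpleGraph (suc d)} (acyclic : Acyclic G) {S : Subset (suc d)} (ρ : RootedSubtree G S)
              {a b : Fin (suc d)} (a∉S : a ∉ₛ S) (b∈S : b ∈ₛ S) (ab : SimpleGraph.Adj G a b) where
  open SimpleGraph G using (Adj; irrefl) renaming (sym to Adj-sym)
  open RootedSubtree ρ

  parent′ : Fin (suc d) → Fin (suc d)
  parent′ = updateAt parent a (λ _ → b)

  depth′ : Fin (suc d) → ℕ
  depth′ = updateAt depth a (λ _ → suc (depth b))

  ∈S⇒≢a : ∀ {v} → v ∈ₛ S → v ≢ a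
  ∈S⇒≢a v∈ refl = a∉S v∈

  a≢root : a ≢ root
  a≢root refl = a∉S root∈

  parent′-a : parent′ a ≡ b
  parent′-a = updateAt-updates a parent

  parent′-old : ∀ {v} → v ∈ₛ S → parent′ v ≡ parent v
  parent′-old v∈ = updateAt-minimal _ a parent (∈S⇒≢a v∈)

  depth′-old : ∀ {v} → v ∈ₛ S → depth′ v ≡ depth v
  depth′-old v∈ = updateAt-minimal _ a depth (∈S⇒≢a v∈)

  parent∈′ : ∀ {v} → v ∈ₛ ⁅ a ⁆ ∪ S → v ≢ root → parent′ v ∈ₛ S
  parent∈′ v∈ v≢root with ∈-⁅⁆∪⁻ v∈
  ... | inj₁ refl = subst (_∈ₛ S) (sym parent′-a) b∈S
  ... | inj₂ v∈S  = subst (_∈ₛ S) (sym (parent′-old v∈S)) (parent∈ v∈S v≢root)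

  parent-adj′ : ∀ {v} → v ∈ₛ ⁅ a ⁆ ∪ S → v ≢ root → Adj v (parent′ v)
  parent-adj′ v∈ v≢root with ∈-⁅⁆∪⁻ v∈
  ... | inj₁ refl = subst (Adj a) (sym parent′-a) ab
  ... | inj₂ v∈S  = subst (Adj _) (sym (parent′-old v∈S)) (parent-adj v∈S v≢root)

  depth-parent′ : ∀ {v} → v ∈ₛ ⁅ a ⁆ ∪ S → v ≢ root → depth′ (parent′ v) < depth′ v
  depth-parent′ v∈ v≢root with ∈-⁅⁆∪⁻ v∈
  ... | inj₁ refl = subst₂ _<_ (trans (sym (depth′-old b∈S)) (cong depth′ (sym parent′-a)))
                               (sym (updateAt-updates a depth)) ℕP.≤-refl
  ... | inj₂ v∈S  = subst₂ _<_ (trans (sym (depth′-old (parent∈ v∈S v≢root)))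
                                      (cong depth′ (sym (parent′-old v∈S))))
                               (sym (depth′-old v∈S)) (depth-parent v∈S v≢root)

  parent-edge′ : ∀ {u w} → u ∈ₛ ⁅ a ⁆ ∪ S → w ∈ₛ ⁅ a ⁆ ∪ S → Adj u w →
                 (u ≢ root × parent′ u ≡ w) ⊎ (w ≢ root × parent′ w ≡ u)
  parent-edge′ u∈ w∈ uw with ∈-⁅⁆∪⁻ u∈ | ∈-⁅⁆∪⁻ w∈
  ... | inj₁ refl | inj₁ refl = ⊥-elim (irrefl uw)
  ... | inj₁ refl | inj₂ w∈S  =
    inj₁ (a≢root , trans parent′-a (sym (uniqueNeighbour ρ acyclic a∉S b∈S w∈S ab uw)))
  ... | inj₂ u∈S  | inj₁ refl =
    inj₂ (a≢root , trans parent′-a (sym (uniqueNeighbour ρ acyclic a∉S b∈S u∈S ab (Adj-sym uw))))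
  ... | inj₂ u∈S  | inj₂ w∈S  with parent-edge u∈S w∈S uw
  ...   | inj₁ (u≢root , pu≡w) = inj₁ (u≢root , trans (parent′-old u∈S) pu≡w)
  ...   | inj₂ (w≢root , pw≡u) = inj₂ (w≢root , trans (parent′-old w∈S) pw≡u)

  rootedSubtree : RootedSubtree G (⁅ a ⁆ ∪ S)
  rootedSubtree = record
    { parent       = parent′
    ; depth        = depth′
    ; root∈        = x∈p∪q⁺ (inj₂ root∈)
    ; parent∈      = λ v∈ v≢root → x∈p∪q⁺ (inj₂ (parent∈′ v∈ v≢root))
    ; parent-adj   = parent-adj′
    ; depth-parent = depth-parent′
    ; parent-edge  = parent-edge′
    }

module _ {d : ℕ} {G : SimpleGraph (suc d)} (acyclic : Acyclic G) where

  includeAlong : ∀ {S x} → Walk G x root → RootedSubtree G S →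
                 ∃ λ S′ → RootedSubtree G S′ × S ⊆ S′ × x ∈ₛ S′
  includeAlong {S} nil ρ = S , ρ , (λ v∈ → v∈) , RootedSubtree.root∈ ρ
  includeAlong {S} {x} (cons xy walk) ρ with includeAlong walk ρ
  ... | S₁ , ρ₁ , S⊆S₁ , y∈S₁ with x ∈ₛ? S₁
  ...   | yes x∈S₁ = S₁ , ρ₁ , S⊆S₁ , x∈S₁
  ...   | no  x∉S₁ = ⁅ x ⁆ ∪ S₁ , Attach.rootedSubtree acyclic ρ₁ x∉S₁ y∈S₁ xy
                   , (λ v∈ → q⊆p∪q ⁅ x ⁆ S₁ (S⊆S₁ v∈)) , x∈p∪q⁺ (inj₁ (x∈⁅x⁆ x))

  includeAll : Connected G → (vs : List (Fin (suc d))) → ∃ λ S → RootedSubtree G S × ListAll.All (_∈ₛ S) vs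
  includeAll connected []       = ⁅ root ⁆ , rootOnly , []
  includeAll connected (v ∷ vs) with includeAll connected vs
  ... | S₁ , ρ₁ , vs∈S₁ with includeAlong (connected v root) ρ₁
  ...   | S₂ , ρ₂ , S₁⊆S₂ , v∈S₂ = S₂ , ρ₂ , v∈S₂ ∷ ListAll.map S₁⊆S₂ vs∈S₁

spanningRootedSubtree : ∀ {d} (G : SimpleGraph (suc d)) → IsTree G →
                        ∃ λ S → RootedSubtree G S × (∀ v → v ∈ₛ S)
spanningRootedSubtree {d} G (connected , acyclic) with includeAll acyclic connected (allFin (suc d))
... | S , ρ , all∈S = S , ρ , λ v → ListAll.lookup all∈S (∈-allFin v)

Centred : ℕ → ℤ → Set
Centred n x = ℤ.- + n ℤ.≤ x × x ℤ.≤ + n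

centred⇔inRange : ∀ n x → Centred n x ⇔ InRange (ℤ.- + n) (n ℕ.+ suc n) x
centred⇔inRange n x = mk⇔
  (λ (lower , upper) → lower , subst (x ℤ.<_) (sym top) (ℤP.i≤pred[j]⇒i<j upper))
  (λ (lower , upper) → lower , ℤP.i<j⇒i≤pred[j] (subst (x ℤ.<_) top upper))
  where
  identity : ∀ a b → ℤ.- a ℤ.+ (a ℤ.+ b) ≡ b
  identity = solve-∀
  top : ℤ.- + n ℤ.+ + (n ℕ.+ suc n) ≡ + suc n
  top = trans (cong (ℤ._+_ (ℤ.- + n)) (ℤP.pos-+ n (suc n))) (identity (+ n) (+ suc n))

module EdgeIncrements {d : ℕ} {G : SimpleGraph (suc d)} {S : Subset (suc d)}
                      (ρ : RootedSubtree G S) (spans : ∀ v → v ∈ₛ S) (n : ℕ) where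
  open SimpleGraph G using (Adj) renaming (sym to Adj-sym)
  open RootedSubtree ρ

  increments : Vec ℤ d → Vec ℤ d
  increments y = restrict (λ v → extend y v ℤ.- extend y (parent v))

  -- the sum of the increments extend t along the first k edges of the path from v to the root
  potentialWithin : Vec ℤ d → ℕ → Fin (suc d) → ℤ
  potentialWithin t zero    v = + 0
  potentialWithin t (suc k) v with v ≟ root
  ... | yes _ = + 0
  ... | no  _ = extend t v ℤ.+ potentialWithin t k (parent v)

  potentialWithin-root : ∀ t k → potentialWithin t (suc k) root ≡ + 0
  potentialWithin-root t k with root {d} ≟ root
  ... | yes _      = refl
  ... | no  r≢root = ⊥-elim (r≢root refl)

  potentialWithin-step : ∀ t k {v} → v ≢ root →
    potentialWithin t (suc k) v ≡ extend t v ℤ.+ potentialWithin t k (parent v)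
  potentialWithin-step t k {v} v≢root with v ≟ root
  ... | yes v≡root = ⊥-elim (v≢root v≡root)
  ... | no  _      = refl

  depth-parent< : ∀ {v k} → v ≢ root → depth v < suc k → depth (parent v) < k
  depth-parent< {v} v≢root (s≤s depth≤k) = ℕP.<-≤-trans (depth-parent (spans v) v≢root) depth≤k

  potentialWithin-stable : ∀ t {k k′} v → depth v < k → depth v < k′ →
    potentialWithin t k v ≡ potentialWithin t k′ v
  potentialWithin-stable t {suc k} {suc k′} v depth<k depth<k′ with v ≟ root
  ... | yes _      = refl
  ... | no  v≢root = cong (ℤ._+_ (extend t v))
          (potentialWithin-stable t (parent v) (depth-parent< v≢root depth<k) (depth-parent< v≢root depth<k′))

  potentialWithin-unique : ∀ t (Z : Fin (suc d) → ℤ) → Z root ≡ + 0 →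
    (∀ {v} → v ≢ root → Z v ≡ extend t v ℤ.+ Z (parent v)) →
    ∀ {k} v → depth v < k → Z v ≡ potentialWithin t k v
  potentialWithin-unique t Z Z-root Z-step {suc k} v depth<k with v ≟ root
  ... | yes refl   = Z-root
  ... | no  v≢root = trans (Z-step v≢root)
          (cong (ℤ._+_ (extend t v))
                (potentialWithin-unique t Z Z-root Z-step (parent v) (depth-parent< v≢root depth<k)))

  potential : Vec ℤ d → Fin (suc d) → ℤ
  potential t v = potentialWithin t (suc (depth v)) v

  potential-root : ∀ t → potential t root ≡ + 0
  potential-root t = potentialWithin-root t (depth root)

  potential-edge : ∀ t {v} → v ≢ root → potential t v ℤ.- potential t (parent v) ≡ extend t v
  potential-edge t {v} v≢root = begin
    potential t v ℤ.- potential t (parent v)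
      ≡⟨ cong (ℤ._- potential t (parent v)) (potentialWithin-step t (depth v) v≢root) ⟩
    (extend t v ℤ.+ potentialWithin t (depth v) (parent v)) ℤ.- potential t (parent v)
      ≡⟨ cong (λ p → (extend t v ℤ.+ p) ℤ.- potential t (parent v))
              (potentialWithin-stable t (parent v) (depth-parent< v≢root ℕP.≤-refl) ℕP.≤-refl) ⟩
    (extend t v ℤ.+ potential t (parent v)) ℤ.- potential t (parent v)
      ≡⟨ identity (extend t v) (potential t (parent v)) ⟩
    extend t v
      ∎
    where
    open ≡-Reasoning
    identity : ∀ a b → (a ℤ.+ b) ℤ.- b ≡ a
    identity = solve-∀

  potential-unique : ∀ t (Z : Fin (suc d) → ℤ) → Z root ≡ + 0 →
    (∀ {v} → v ≢ root → Z v ≡ extend t v ℤ.+ Z (parent v)) → ∀ v → Z v ≡ potential t v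
  potential-unique t Z Z-root Z-step v = potentialWithin-unique t Z Z-root Z-step v ℕP.≤-refl

  heights : Vec ℤ d → Vec ℤ d
  heights t = restrict (potential t)

  extend-heights : ∀ t v → extend (heights t) v ≡ potential t v
  extend-heights t = extend-restrict (potential t) (potential-root t)

  inject₁≢root : ∀ (i : Fin d) → inject₁ i ≢ root
  inject₁≢root i = fromℕ≢inject₁ ∘ sym

  Box : Vec ℤ d → Set
  Box = All (InRange (ℤ.- + n) (n ℕ.+ suc n))

  increments-∈ : ∀ {y} → InDilatedDual G n y → Box (increments y)
  increments-∈ {y} y∈ = lookup⁻ λ i →
    subst (InRange (ℤ.- + n) (n ℕ.+ suc n)) (sym (VecP.lookup∘tabulate (λ j → increment (inject₁ j)) i))
          (to (centred⇔inRange n _) (centred (inject₁≢root i)))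
    where
    Y : Fin (suc d) → ℤ
    Y = extend y
    increment : Fin (suc d) → ℤ
    increment v = Y v ℤ.- Y (parent v)
    bounded : EdgeBounded G n Y
    bounded = to (inDilatedDual⇔edgeBounded G n y) y∈
    centred : ∀ {v} → v ≢ root → Centred n (increment v)
    centred {v} v≢root =
      subst (ℤ.- + n ℤ.≤_) (neg-minus (Y (parent v)) (Y v)) (ℤP.neg-mono-≤ (bounded (Adj-sym edge))) , bounded edge
      where
      edge : Adj v (parent v)
      edge = parent-adj (spans v) v≢root

  heights-∈ : ∀ {t} → Box t → InDilatedDual G n (heights t)
  heights-∈ {t} t∈ = from (inDilatedDual⇔edgeBounded G n (heights t)) λ {u} {w} uw →
    subst (ℤ._≤ + n) (sym (cong₂ ℤ._-_ (extend-heights t u) (extend-heights t w))) (bounded uw)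
    where
    P : Fin (suc d) → ℤ
    P = potential t
    centred : ∀ {v} → v ≢ root → Centred n (extend t v)
    centred v≢root = from (centred⇔inRange n _) (extend-All t∈ v≢root)
    bounded : ∀ {u w} → Adj u w → P u ℤ.- P w ℤ.≤ + n
    bounded {u} {w} uw with parent-edge (spans u) (spans w) uw
    ... | inj₁ (u≢root , refl) = subst (ℤ._≤ + n) (sym (potential-edge t u≢root)) (proj₂ (centred u≢root))
    ... | inj₂ (w≢root , refl) =
      subst₂ ℤ._≤_ (trans (cong ℤ.-_ (sym (potential-edge t w≢root))) (neg-minus (P w) (P (parent w))))
                   (ℤP.neg-involutive (+ n))
                   (ℤP.neg-mono-≤ (proj₁ (centred w≢root)))

  increments∘heights : ∀ t → increments (heights t) ≡ t
  increments∘heights t = trans (VecP.tabulate-cong pointwise) (VecP.tabulate∘lookup t)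
    where
    open ≡-Reasoning
    pointwise : ∀ i → extend (heights t) (inject₁ i) ℤ.- extend (heights t) (parent (inject₁ i)) ≡ lookup t i
    pointwise i = begin
      extend (heights t) (inject₁ i) ℤ.- extend (heights t) (parent (inject₁ i))
        ≡⟨ cong₂ ℤ._-_ (extend-heights t (inject₁ i)) (extend-heights t (parent (inject₁ i))) ⟩
      potential t (inject₁ i) ℤ.- potential t (parent (inject₁ i)) ≡⟨ potential-edge t (inject₁≢root i) ⟩
      extend t (inject₁ i)                                          ≡⟨ extend-inject₁ t i ⟩
      lookup t i                                                    ∎

  heights∘increments : ∀ y → heights (increments y) ≡ y
  heights∘increments y = trans (VecP.tabulate-cong (λ i → sym (Y≡potential (inject₁ i)))) (restrict-extend y)
    where
    Y : Fin (suc d) → ℤ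
    Y = extend y
    identity : ∀ a b → a ≡ (a ℤ.- b) ℤ.+ b
    identity = solve-∀
    Y≡potential : ∀ v → Y v ≡ potential (increments y) v
    Y≡potential = potential-unique (increments y) Y (extend-last y) λ {v} v≢root →
      trans (identity (Y v) (Y (parent v)))
            (cong (ℤ._+ Y (parent v)) (sym (extend-restrict-≢ (λ w → Y w ℤ.- Y (parent w)) v≢root)))

  bijection : SubsetBijection (InDilatedDual G n) Box
  bijection = record
    { forward          = increments
    ; backward         = heights
    ; forward-∈        = increments-∈
    ; backward-∈       = heights-∈
    ; backward∘forward = λ {y} _ → heights∘increments y
    ; forward∘backward = λ {t} _ → increments∘heights t
    }

proposition4p1 : (d : ℕ) → 1 ≤ d → (G : SimpleGraph (suc d)) →
    IsTree G ⊎ IsComplete G → EhrhartDualMagicPositive d G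
proposition4p1 d _ G (inj₁ tree) with spanningRootedSubtree G tree
... | S , ρ , spans =
  magicExpansion⇒magicPositive d G (λ i → d C toℕ i) (λ n → (n ℕ.+ suc n) ℕ.^ d)
    (λ n → HasCard-bijection (EdgeIncrements.bijection ρ spans n) (HasCard-box d (ℤ.- + n) (n ℕ.+ suc n)))
    (binomial-magic d)
proposition4p1 d _ G (inj₂ complete) =
  magicExpansion⇒magicPositive d G (λ _ → 1) (λ n → containingCount n (suc d))
    (λ n → HasCard-bijection (CompleteGraph.normalisation G complete n) (HasCard-boxContainingZero (suc d) n))
    (λ n → trans (containingCount-magic d n)
                 (sum-cong-≗ {suc d} (λ i → sym (ℕP.*-identityˡ (magicTerm d n (toℕ i))))))
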